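{- Let $n>1$, let $k_0,\ldots,k_{n-1}$ be integers and $q,p_0,\ldots,p_{n-1}$ non-zero integers with $\gcd(p_i,q)=1$ for all $i$, and assume $D:=q^n-p_0p_1\cdots p_{n-1}\neq 0$. Extend indices periodically modulo $n$, let $B_i(x)=\frac{p_ix+k_i}{q}$, and let $x_i$ be the unique rational solution of $B_i\circ B_{i+1}\circ\cdots\circ B_{i+n-1}(x)=x$, namely $$x_i=\frac{p_ip_{i+1}\cdots p_{i+n-2}k_{i-1}+p_ip_{i+1}\cdots p_{i+n-3}k_{i-2}q+\cdots+p_ik_{i+1}q^{n-2}+k_iq^{n-1}}{D}.$$ If for some $j\in\{0,1,\ldots,n-1\}$ the number $x_j$, written in lowest terms, has denominator $d$, then for every $i=0,1,\ldots,n-1$ the number $x_i$, written in lowest terms, also has denominator $d$.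
   Context: All indices are taken modulo $n$. -}

module Defs where

open import Data.Nat as ℕ using (ℕ; zero; suc; _∸_)
open import Data.Nat.DivMod using (_mod_)
open import Data.Fin using (Fin; toℕ)
open import Data.List using (List; upTo; map; foldr)
open import Data.Integer as ℤ using (ℤ; 0ℤ; 1ℤ; _+_; _*_; _-_; _^_)
open import Data.Rational as ℚ using (ℚ; _/_)
open import Data.Integer using (∣_∣; sign; _◃_)
open import Relation.Binary.PropositionalEquality using (_≢_)

Σℤ : ℕ → (ℕ → ℤ) → ℤ
Σℤ m f = foldr _+_ 0ℤ (map f (upTo m))

Πℤ : ℕ → (ℕ → ℤ) → ℤ
Πℤ m f = foldr _*_ 1ℤ (map f (upTo m))

at : (n : ℕ) → (Fin n → ℤ) → ℕ → ℤ
at zero    f j = 0ℤ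
at (suc m) f j = f (j mod suc m)

D : (n : ℕ) → (p : Fin n → ℤ) → (q : ℤ) → ℤ
D n p q = q ^ n - Πℤ n (at n p)

-- numerator of x_i:
--   Σ_{j=0}^{n-1} (p_i p_{i+1} ... p_{i+j-1}) k_{i+j} q^{n-1-j}
-- (the term j = n - m is  p_i...p_{i+n-1-m} k_{i-m} q^{m-1}, m = 1..n,
--  exactly the paper's formula, indices mod n)
Num : (n : ℕ) → (k p : Fin n → ℤ) → (q : ℤ) → Fin n → ℤ
Num n k p q i =
  Σℤ n (λ j → Πℤ j (λ t → at n p (toℕ i ℕ.+ t)) * at n k (toℕ i ℕ.+ j) * q ^ (n ∸ 1 ∸ j))

-- x_i = Num_i / D  as a rational number (ℚ is always in lowest terms),
-- computed as (sign(D) · Num_i) / |D|  (the stdlib ℚ._/_ takes a positive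
-- natural denominator and normalises)
x : (n : ℕ) → (k p : Fin n → ℤ) → (q : ℤ) → D n p q ≢ 0ℤ → Fin n → ℚ
x n k p q D≢0 i =
  ((sign (D n p q) ◃ 1) * Num n k p q i / ∣ D n p q ∣) {{ℤ.≢-nonZero D≢0}}

-- Write Nᵢ for the numerator of xᵢ. Since xᵢ = Bᵢ(xᵢ₊₁), clearing denominators gives
-- q Nᵢ = pᵢ Nᵢ₊₁ + kᵢ D. Both pᵢ and q are coprime to D = qⁿ - p₀⋯pₙ₋₁, because p₀⋯pₙ₋₁ and qⁿ
-- are coprime; so any common divisor of D with Nᵢ divides Nᵢ₊₁ and conversely. Hence
-- gcd(Nᵢ, D) does not depend on i, and neither does the reduced denominator |D| / gcd(Nᵢ, D).
module Submission where

open import Function using (_∘_; id)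
open import Data.Nat as ℕ using (ℕ; zero; suc; _∸_; _<_)
import Data.Nat.Properties as ℕ
open import Data.Nat.DivMod using (_mod_; [m+n]%n≡m%n)
import Data.Nat.Divisibility as ℕ
import Data.Nat.GCD as ℕ
open import Data.Fin using (Fin; toℕ)
import Data.Fin.Properties as Fin
open import Data.List using (upTo; map; foldr)
open import Data.List.Properties using (map-applyUpTo; map-cong)
open import Data.Integer as ℤ using (ℤ; +_; 0ℤ; 1ℤ; _+_; _*_; -_; _-_; _^_; ∣_∣; sign; _◃_)
import Data.Integer.Properties as ℤ
open import Data.Integer.Tactic.RingSolver using (solve-∀)
open import Data.Integer.Divisibility using () renaming (_∣_ to _∣ᵤ_)
open import Data.Integer.Divisibility.Signed
  using (_∣_; ∣ᵤ⇒∣; ∣⇒∣ᵤ; ∣-refl; ∣m∣n⇒∣m+n; ∣m∣n⇒∣m-n; ∣m+n∣n⇒∣m; ∣n⇒∣m*n; ∣m⇒∣m*n)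
open import Data.Integer.Coprimality as Coprimality using (Coprime; coprime-divisor)
open import Data.Integer.GCD using (gcd; gcd[i,j]∣i; gcd[i,j]∣j; gcd-greatest)
open import Data.Rational using (↧_; ↧ₙ_; _/_)
import Data.Rational.Properties as ℚ
open import Data.Product using (_×_; _,_; proj₁; proj₂)
open import Data.Sum using (inj₂)
open import Relation.Binary.PropositionalEquality
open ≡-Reasoning
open import Defs

Σℤ-suc : ∀ m f → Σℤ (suc m) f ≡ f 0 + Σℤ m (f ∘ suc)
Σℤ-suc m f = cong (λ xs → f 0 + foldr _+_ 0ℤ xs)
  (trans (map-applyUpTo suc f m) (sym (map-applyUpTo id (f ∘ suc) m)))

Πℤ-suc : ∀ m f → Πℤ (suc m) f ≡ f 0 * Πℤ m (f ∘ suc)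
Πℤ-suc m f = cong (λ xs → f 0 * foldr _*_ 1ℤ xs)
  (trans (map-applyUpTo suc f m) (sym (map-applyUpTo id (f ∘ suc) m)))

Σℤ-cong : ∀ m {f g : ℕ → ℤ} → (∀ t → f t ≡ g t) → Σℤ m f ≡ Σℤ m g
Σℤ-cong m f≗g = cong (foldr _+_ 0ℤ) (map-cong f≗g (upTo m))

Πℤ-cong : ∀ m {f g : ℕ → ℤ} → (∀ t → f t ≡ g t) → Πℤ m f ≡ Πℤ m g
Πℤ-cong m f≗g = cong (foldr _*_ 1ℤ) (map-cong f≗g (upTo m))

*-distribˡ-Σℤ : ∀ c m f → c * Σℤ m f ≡ Σℤ m (λ t → c * f t)
*-distribˡ-Σℤ c zero    f = ℤ.*-zeroʳ c
*-distribˡ-Σℤ c (suc m) f = begin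
  c * Σℤ (suc m) f                          ≡⟨ cong (c *_) (Σℤ-suc m f) ⟩
  c * (f 0 + Σℤ m (f ∘ suc))                ≡⟨ ℤ.*-distribˡ-+ c (f 0) _ ⟩
  c * f 0 + c * Σℤ m (f ∘ suc)              ≡⟨ cong (_+_ (c * f 0)) (*-distribˡ-Σℤ c m (f ∘ suc)) ⟩
  c * f 0 + Σℤ m (λ t → c * f (suc t))      ≡⟨ Σℤ-suc m (λ t → c * f t) ⟨
  Σℤ (suc m) (λ t → c * f t)                ∎

Πℤ-snoc : ∀ m f → Πℤ (suc m) f ≡ Πℤ m f * f m
Πℤ-snoc zero    f = ℤ.*-comm (f 0) 1ℤ
Πℤ-snoc (suc m) f = begin
  Πℤ (suc (suc m)) f                        ≡⟨ Πℤ-suc (suc m) f ⟩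
  f 0 * Πℤ (suc m) (f ∘ suc)                ≡⟨ cong (f 0 *_) (Πℤ-snoc m (f ∘ suc)) ⟩
  f 0 * (Πℤ m (f ∘ suc) * f (suc m))        ≡⟨ ℤ.*-assoc (f 0) _ _ ⟨
  f 0 * Πℤ m (f ∘ suc) * f (suc m)          ≡⟨ cong (_* f (suc m)) (Πℤ-suc m f) ⟨
  Πℤ (suc m) f * f (suc m)                  ∎

Πℤ-rotate : ∀ n (f : ℕ → ℤ) → (∀ m → f (m ℕ.+ n) ≡ f m) →
            ∀ m → Πℤ n (λ t → f (m ℕ.+ t)) ≡ Πℤ n f
Πℤ-rotate n f periodic zero    = refl
Πℤ-rotate n f periodic (suc m) = begin
  Πℤ n (λ t → f (suc m ℕ.+ t))  ≡⟨ Πℤ-cong n (λ t → cong f (ℕ.+-suc m t)) ⟨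
  Πℤ n (fₘ ∘ suc)               ≡⟨ rotate-once n fₘ-periodic ⟩
  Πℤ n fₘ                       ≡⟨ Πℤ-rotate n f periodic m ⟩
  Πℤ n f                        ∎
  where
  fₘ : ℕ → ℤ
  fₘ t = f (m ℕ.+ t)
  fₘ-periodic : fₘ n ≡ fₘ 0
  fₘ-periodic = trans (periodic m) (cong f (sym (ℕ.+-identityʳ m)))
  rotate-once : ∀ n → fₘ n ≡ fₘ 0 → Πℤ n (fₘ ∘ suc) ≡ Πℤ n fₘ
  rotate-once zero    _ = refl
  rotate-once (suc r) e = begin
    Πℤ (suc r) (fₘ ∘ suc)       ≡⟨ Πℤ-snoc r (fₘ ∘ suc) ⟩
    Πℤ r (fₘ ∘ suc) * fₘ (suc r) ≡⟨ cong (Πℤ r (fₘ ∘ suc) *_) e ⟩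
    Πℤ r (fₘ ∘ suc) * fₘ 0       ≡⟨ ℤ.*-comm _ (fₘ 0) ⟩
    fₘ 0 * Πℤ r (fₘ ∘ suc)       ≡⟨ Πℤ-suc r fₘ ⟨
    Πℤ (suc r) fₘ                ∎

-- Num n k p q i unfolds to cycleNumerator q n (λ t → at n p (toℕ i + t)) (λ t → at n k (toℕ i + t)).
cycleNumerator : ℤ → ℕ → (ℕ → ℤ) → (ℕ → ℤ) → ℤ
cycleNumerator q m p k = Σℤ m (λ j → Πℤ j p * k j * q ^ (m ∸ 1 ∸ j))

module _ (q : ℤ) where

  cycleNumerator-cong : ∀ m {p p′ k k′ : ℕ → ℤ} → (∀ t → p t ≡ p′ t) → (∀ t → k t ≡ k′ t) →
                        cycleNumerator q m p k ≡ cycleNumerator q m p′ k′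
  cycleNumerator-cong m p≗p′ k≗k′ = Σℤ-cong m λ j →
    cong₂ (λ a b → a * b * q ^ (m ∸ 1 ∸ j)) (Πℤ-cong j p≗p′) (k≗k′ j)

  cycleNumerator-suc : ∀ m p k →
    cycleNumerator q (suc m) p k ≡ k 0 * q ^ m + p 0 * cycleNumerator q m (p ∘ suc) (k ∘ suc)
  cycleNumerator-suc m p k = begin
    cycleNumerator q (suc m) p k
      ≡⟨ Σℤ-suc m (λ j → Πℤ j p * k j * q ^ (m ∸ j)) ⟩
    1ℤ * k 0 * q ^ m + Σℤ m (λ j → Πℤ (suc j) p * k (suc j) * q ^ (m ∸ suc j))
      ≡⟨ cong₂ _+_ (cong (_* q ^ m) (ℤ.*-identityˡ (k 0))) (Σℤ-cong m factor-p₀) ⟩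
    k 0 * q ^ m + Σℤ m (λ j → p 0 * (Πℤ j (p ∘ suc) * k (suc j) * q ^ (m ∸ 1 ∸ j)))
      ≡⟨ cong (_+_ (k 0 * q ^ m)) (*-distribˡ-Σℤ (p 0) m _) ⟨
    k 0 * q ^ m + p 0 * cycleNumerator q m (p ∘ suc) (k ∘ suc)
      ∎
    where
    reassoc : ∀ a b c d → a * b * c * d ≡ a * (b * c * d)
    reassoc = solve-∀
    factor-p₀ : ∀ j → Πℤ (suc j) p * k (suc j) * q ^ (m ∸ suc j)
                    ≡ p 0 * (Πℤ j (p ∘ suc) * k (suc j) * q ^ (m ∸ 1 ∸ j))
    factor-p₀ j = trans
      (cong₂ (λ a e → a * k (suc j) * q ^ e) (Πℤ-suc j p) (sym (ℕ.∸-+-assoc m 1 j)))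
      (reassoc (p 0) _ _ _)

  cycleNumerator-shift : ∀ m p k →
    q * cycleNumerator q m p k
      ≡ p 0 * cycleNumerator q m (p ∘ suc) (k ∘ suc) + k 0 * q ^ m - Πℤ m p * k m
  cycleNumerator-shift zero    p k = empty-sum q (p 0) (k 0)
    where
    empty-sum : ∀ q a b → q * 0ℤ ≡ a * 0ℤ + b * 1ℤ - 1ℤ * b
    empty-sum = solve-∀
  cycleNumerator-shift (suc m) p k = begin
    q * cycleNumerator q (suc m) p k
      ≡⟨ cong (q *_) (cycleNumerator-suc m p k) ⟩
    q * (k 0 * q ^ m + p 0 * N′)
      ≡⟨ distribute q (k 0) (p 0) (q ^ m) N′ ⟩
    k 0 * q ^ suc m + p 0 * (q * N′)
      ≡⟨ cong (λ z → k 0 * q ^ suc m + p 0 * z) (cycleNumerator-shift m (p ∘ suc) (k ∘ suc)) ⟩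
    k 0 * q ^ suc m + p 0 * (p 1 * N″ + k 1 * q ^ m - Πℤ m (p ∘ suc) * k (suc m))
      ≡⟨ regroup q (k 0) (p 0) (p 1) (k 1) (q ^ m) N″ (Πℤ m (p ∘ suc)) (k (suc m)) ⟩
    p 0 * (k 1 * q ^ m + p 1 * N″) + k 0 * q ^ suc m - p 0 * Πℤ m (p ∘ suc) * k (suc m)
      ≡⟨ cong₂ (λ a b → p 0 * a + k 0 * q ^ suc m - b * k (suc m))
               (cycleNumerator-suc m (p ∘ suc) (k ∘ suc)) (Πℤ-suc m p) ⟨
    p 0 * cycleNumerator q (suc m) (p ∘ suc) (k ∘ suc) + k 0 * q ^ suc m - Πℤ (suc m) p * k (suc m)
      ∎
    where
    N′ = cycleNumerator q m (p ∘ suc) (k ∘ suc)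
    N″ = cycleNumerator q m (p ∘ suc ∘ suc) (k ∘ suc ∘ suc)
    distribute : ∀ q a b Q N → q * (a * Q + b * N) ≡ a * (q * Q) + b * (q * N)
    distribute = solve-∀
    regroup : ∀ q a b c d Q N P e →
      a * (q * Q) + b * (c * N + d * Q - P * e) ≡ b * (d * Q + c * N) + a * (q * Q) - b * P * e
    regroup = solve-∀

coprime-1 : ∀ a → Coprime a 1ℤ
coprime-1 a (_ , d∣1) = ℕ.∣1⇒≡1 d∣1

coprime-* : ∀ {a b c} → Coprime a b → Coprime a c → Coprime a (b * c)
coprime-* {a} {b} {c} a⊥b a⊥c {d} (d∣a , d∣bc) = a⊥c (d∣a , coprime-divisor (+ d) b c d⊥b d∣bc)
  where
  d⊥b : Coprime (+ d) b
  d⊥b (e∣d , e∣b) = a⊥b (ℕ.∣-trans e∣d d∣a , e∣b)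

coprime-^ : ∀ {a b} → Coprime a b → ∀ m → Coprime a (b ^ m)
coprime-^ {a}     a⊥b zero    = coprime-1 a
coprime-^ {a} {b} a⊥b (suc m) = coprime-* {a} {b} {b ^ m} a⊥b (coprime-^ {a} a⊥b m)

coprime-Πℤ : ∀ {a} {f : ℕ → ℤ} → (∀ t → Coprime a (f t)) → ∀ m → Coprime a (Πℤ m f)
coprime-Πℤ {a} a⊥f zero    = coprime-1 a
coprime-Πℤ {a} {f} a⊥f (suc m) = subst (Coprime a) (sym (Πℤ-suc m f))
  (coprime-* {a} {f 0} {Πℤ m (f ∘ suc)} (a⊥f 0) (coprime-Πℤ {a} {f ∘ suc} (a⊥f ∘ suc) m))

coprime-∣ʳ : ∀ {a b c} → Coprime a b → c ∣ b → Coprime a c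
coprime-∣ʳ a⊥b c∣b (d∣a , d∣c) = a⊥b (d∣a , ℕ.∣-trans d∣c (∣⇒∣ᵤ c∣b))

coprime-difference : ∀ {i j} → Coprime i j → Coprime (j - i) i × Coprime (j - i) j
coprime-difference {i} {j} i⊥j =
  (λ {d} (d∣j-i , d∣i) → i⊥j (d∣i , ∣⇒∣ᵤ (subst (+ d ∣_) (j-i+i j i)
    (∣m∣n⇒∣m+n {+ d} {j - i} {i} (∣ᵤ⇒∣ d∣j-i) (∣ᵤ⇒∣ d∣i))))) ,
  (λ {d} (d∣j-i , d∣j) → i⊥j (∣⇒∣ᵤ (subst (+ d ∣_) (j-[j-i] j i)
    (∣m∣n⇒∣m-n {+ d} {j} {j - i} (∣ᵤ⇒∣ d∣j) (∣ᵤ⇒∣ d∣j-i))) , d∣j))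
  where
  j-i+i : ∀ j i → j - i + i ≡ j
  j-i+i = solve-∀
  j-[j-i] : ∀ j i → j - (j - i) ≡ i
  j-[j-i] = solve-∀

gcd-∣-gcd : ∀ {u v w a b D} → Coprime v D → u * a ≡ v * b + w * D → gcd a D ∣ᵤ gcd b D
gcd-∣-gcd {u} {v} {w} {a} {b} {D} v⊥D ua≡vb+wD =
  gcd-greatest {b} {D} {g} (coprime-divisor g v b g⊥v (∣⇒∣ᵤ g∣vb)) (gcd[i,j]∣j a D)
  where
  g = gcd a D
  g∣a : g ∣ a
  g∣a = ∣ᵤ⇒∣ (gcd[i,j]∣i a D)
  g∣D : g ∣ D
  g∣D = ∣ᵤ⇒∣ (gcd[i,j]∣j a D)
  g∣vb : g ∣ v * b
  g∣vb = ∣m+n∣n⇒∣m (subst (g ∣_) ua≡vb+wD (∣n⇒∣m*n u g∣a)) (∣n⇒∣m*n w g∣D)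
  g⊥v : Coprime g v
  g⊥v = Coprimality.sym {v} {g} (coprime-∣ʳ {v} {D} {g} v⊥D g∣D)

gcd-invariant : ∀ {u v w a b D} → Coprime u D → Coprime v D →
                u * a ≡ v * b + w * D → gcd a D ≡ gcd b D
gcd-invariant {u} {v} {w} {a} {b} {D} u⊥D v⊥D ua≡vb+wD =
  cong +_ (ℕ.∣-antisym (gcd-∣-gcd {u} {v} {w} {a} {b} {D} v⊥D ua≡vb+wD)
                       (gcd-∣-gcd {v} {u} { - w} {b} {a} {D} u⊥D vb≡ua-wD))
  where
  move : ∀ x w D → x ≡ x + w * D + - w * D
  move = solve-∀
  vb≡ua-wD : v * b ≡ u * a + - w * D
  vb≡ua-wD = trans (move (v * b) w D) (cong (_+ - w * D) (sym ua≡vb+wD))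

↧-signed-/ : ∀ s z m .{{_ : ℕ.NonZero m}} → ↧ ((s ◃ 1) * z / m) * gcd z (+ m) ≡ + m
↧-signed-/ s z m = trans (cong (λ g → ↧ ((s ◃ 1) * z / m) * + ℕ.gcd g m) (sym ∣sz∣≡∣z∣))
                          (ℚ.↧-/ ((s ◃ 1) * z) m)
  where
  ∣sz∣≡∣z∣ : ∣ (s ◃ 1) * z ∣ ≡ ∣ z ∣
  ∣sz∣≡∣z∣ = trans (ℤ.abs-* (s ◃ 1) z) (trans (cong (ℕ._* ∣ z ∣) (ℤ.abs-◃ s 1)) (ℕ.*-identityˡ ∣ z ∣))

module Periodic (r : ℕ) (k p : Fin (suc r) → ℤ) (q : ℤ) where

  n : ℕ
  n = suc r

  A K : ℕ → ℤ
  A = at n p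
  K = at n k

  at-periodic : ∀ (f : Fin n → ℤ) m → at n f (m ℕ.+ n) ≡ at n f m
  at-periodic f m = cong f (Fin.fromℕ<-cong _ _ ([m+n]%n≡m%n m n) _ _)

  N : ℕ → ℤ
  N m = cycleNumerator q n (λ t → A (m ℕ.+ t)) (λ t → K (m ℕ.+ t))

  N-recurrence : ∀ m → q * N m ≡ A m * N (suc m) + K m * D n p q
  N-recurrence m = begin
    q * N m
      ≡⟨ cycleNumerator-shift q n Aₘ Kₘ ⟩
    A (m ℕ.+ 0) * cycleNumerator q n (Aₘ ∘ suc) (Kₘ ∘ suc) + K (m ℕ.+ 0) * q ^ n - Πℤ n Aₘ * K (m ℕ.+ n)
      ≡⟨ cong₂ (λ a b → a * cycleNumerator q n (Aₘ ∘ suc) (Kₘ ∘ suc) + b * q ^ n - Πℤ n Aₘ * K (m ℕ.+ n))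
               (cong A (ℕ.+-identityʳ m)) (cong K (ℕ.+-identityʳ m)) ⟩
    A m * cycleNumerator q n (Aₘ ∘ suc) (Kₘ ∘ suc) + K m * q ^ n - Πℤ n Aₘ * K (m ℕ.+ n)
      ≡⟨ cong₂ (λ a b → A m * a + K m * q ^ n - b)
               (cycleNumerator-cong q n (λ t → cong A (ℕ.+-suc m t)) (λ t → cong K (ℕ.+-suc m t)))
               (cong₂ _*_ (Πℤ-rotate n A (at-periodic p) m) (at-periodic k m)) ⟩
    A m * N (suc m) + K m * q ^ n - Πℤ n A * K m
      ≡⟨ factor-K (A m) (N (suc m)) (K m) (q ^ n) (Πℤ n A) ⟩
    A m * N (suc m) + K m * D n p q
      ∎
    where
    Aₘ Kₘ : ℕ → ℤ
    Aₘ t = A (m ℕ.+ t)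
    Kₘ t = K (m ℕ.+ t)
    factor-K : ∀ a N c Q P → a * N + c * Q - P * c ≡ a * N + c * (Q - P)
    factor-K = solve-∀

  A∣ΠA : ∀ m → A m ∣ Πℤ n A
  A∣ΠA m = subst₂ _∣_ (cong A (ℕ.+-identityʳ m))
                      (trans (sym (Πℤ-suc r (λ t → A (m ℕ.+ t)))) (Πℤ-rotate n A (at-periodic p) m))
                      (∣m⇒∣m*n _ ∣-refl)

  module _ (p⊥q : ∀ i → Coprime (p i) q) where

    A⊥q : ∀ t → Coprime (A t) q
    A⊥q t = p⊥q (t mod n)

    D⊥ΠA×D⊥qⁿ : Coprime (D n p q) (Πℤ n A) × Coprime (D n p q) (q ^ n)
    D⊥ΠA×D⊥qⁿ = coprime-difference {Πℤ n A} {q ^ n}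
      (Coprimality.sym {q ^ n} {Πℤ n A}
        (coprime-Πℤ {q ^ n} {A} (λ t → Coprimality.sym {A t} {q ^ n} (coprime-^ {A t} {q} (A⊥q t) n)) n))

    A⊥D : ∀ m → Coprime (A m) (D n p q)
    A⊥D m = Coprimality.sym {D n p q} {A m}
      (coprime-∣ʳ {D n p q} {Πℤ n A} {A m} (proj₁ D⊥ΠA×D⊥qⁿ) (A∣ΠA m))

    q⊥D : Coprime q (D n p q)
    q⊥D = Coprimality.sym {D n p q} {q}
      (coprime-∣ʳ {D n p q} {q ^ n} {q} (proj₂ D⊥ΠA×D⊥qⁿ) (∣m⇒∣m*n {q} {q} (q ^ r) ∣-refl))

    gcd-N-constant : ∀ m → gcd (N m) (D n p q) ≡ gcd (N 0) (D n p q)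
    gcd-N-constant zero    = refl
    gcd-N-constant (suc m) =
      trans (sym (gcd-invariant {q} {A m} {K m} q⊥D (A⊥D m) (N-recurrence m))) (gcd-N-constant m)

corollary3p4 : (n : ℕ) → 1 < n → (k p : Fin n → ℤ) → (q : ℤ) → q ≢ 0ℤ
    → (∀ i → p i ≢ 0ℤ) → (∀ i → Coprime (p i) q)
    → (D≢0 : D n p q ≢ 0ℤ)
    → (j : Fin n) (d : ℕ) → ↧ₙ (x n k p q D≢0 j) ≡ d
    → (i : Fin n) → ↧ₙ (x n k p q D≢0 i) ≡ d
corollary3p4 zero ()
corollary3p4 (suc r) _ k p q _ _ p⊥q D≢0 j _ refl i =
  ℤ.+-injective (ℤ.*-cancelʳ-≡ _ _ g (trans (↧x*g≡∣D∣ i) (sym (↧x*g≡∣D∣ j))))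
  where
  open Periodic r k p q
  g : ℤ
  g = gcd (N 0) (D n p q)
  instance
    g-nonZero : ℤ.NonZero g
    g-nonZero = ℕ.≢-nonZero (ℕ.gcd[m,n]≢0 ∣ N 0 ∣ ∣ D n p q ∣ (inj₂ (D≢0 ∘ ℤ.∣i∣≡0⇒i≡0)))
    D-nonZero : ℤ.NonZero (D n p q)
    D-nonZero = ℤ.≢-nonZero D≢0
  ↧x*g≡∣D∣ : ∀ i → ↧ (x n k p q D≢0 i) * g ≡ + ∣ D n p q ∣
  ↧x*g≡∣D∣ i = trans (cong (↧ (x n k p q D≢0 i) *_) (sym (gcd-N-constant p⊥q (toℕ i))))
                      (↧-signed-/ (sign (D n p q)) (N (toℕ i)) ∣ D n p q ∣)
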